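{- Let $R$ be injective and univalent. Then $R$ is a path if and only if there exists a point $p$ such that $p\mathbin{;}R\subseteq R^*\cup R^{\top*}$.
   Context: $(B,\cup,\mathbin{;},\overline{\,\cdot\,},{}^{\top},{}^{*},\mathsf{I})$ is a Kleene relation algebra; all variables range over $B$. That is, $(B,\cup,\mathbin{;},\overline{\,\cdot\,},{}^{\top},\mathsf{I})$ is a relation algebra: $\cup$ is associative and commutative and $R=\overline{\overline{R}\cup\overline{S}}\cup\overline{\overline{R}\cup S}$; $\mathbin{;}$ is associative, $(R\cup S)\mathbin{;}T=R\mathbin{;}T\cup S\mathbin{;}T$, $R\mathbin{;}\mathsf{I}=R$; $(R^{\top})^{\top}=R$, $(R\cup S)^{\top}=R^{\top}\cup S^{\top}$, $(R\mathbin{;}S)^{\top}=S^{\top}\mathbin{;}R^{\top}$; $R^{\top}\mathbin{;}\overline{R\mathbin{;}S}\cup\overline{S}=\overline{S}$. The order is $R\subseteq S$ iff $R\cup S=S$; $R\cap S=\overline{\overline{R}\cup\overline{S}}$; $\mathsf{L}=R\cup\overline{R}$ is the greatest and $\mathsf{O}=R\cap\overline{R}$ the least element. The star satisfies $\mathsf{I}\cup R\mathbin{;}R^*\subseteq R^*$, $\mathsf{I}\cup R^*\mathbin{;}R\subseteq R^*$, $S\cup R\mathbin{;}Q\subseteq Q\Rightarrow R^*\mathbin{;}S\subseteq Q$, $S\cup Q\mathbin{;}R\subseteq Q\Rightarrow S\mathbin{;}R^*\subseteq Q$. Write $R^{\top*}=(R^{\top})^*$. The algebra satisfies the Tarski rule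 ($R\neq\mathsf{O}$ iff $\mathsf{L}\mathbin{;}R\mathbin{;}\mathsf{L}=\mathsf{L}$) and the point axiom (for every $R\neq\mathsf{O}$ there are points $p,q$ with $p\mathbin{;}q^{\top}\subseteq R$). A point is an element $p$ with $p=p\mathbin{;}\mathsf{L}$, $p\mathbin{;}p^{\top}\subseteq\mathsf{I}$ and $\mathsf{I}\subseteq p^{\top}\mathbin{;}p$. Composition binds tighter than $\cup,\cap$; complement and converse bind tighter than composition. $R$ is univalent if $R^{\top}\mathbin{;}R\subseteq\mathsf{I}$ and injective if $R\mathbin{;}R^{\top}\subseteq\mathsf{I}$. $R$ is connected if $R\mathbin{;}\mathsf{L}\mathbin{;}R\subseteq R^*\cup R^{\top*}$; $R$ is a path if it is injective, univalent and connected. -}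

module Defs where

open import Level using (Level; suc)
open import Relation.Binary.PropositionalEquality using (_≡_)
open import Relation.Nullary using (¬_)
open import Data.Product using (Σ; ∃; _×_)
open import Data.Sum using (_⊎_)


record KleeneRelationAlgebra (ℓ : Level) : Set (suc ℓ) where
  infixr 5 _∪_
  infixr 6 _∩_
  infixr 7 _⨾_
  infix 9 ∁_ _ᵀ _*
  infix 4 _⊆_
  field
    B    : Set ℓ
    _∪_  : B → B → B
    _⨾_  : B → B → B
    ∁_   : B → B
    _ᵀ   : B → B
    _*   : B → B
    I    : B

  _⊆_ : B → B → Set ℓ
  R ⊆ S = R ∪ S ≡ S

  _∩_ : B → B → B
  R ∩ S = ∁ (∁ R ∪ ∁ S)

  L : B
  L = I ∪ ∁ I

  O : B
  O = I ∩ ∁ I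

  field
    ∪-assoc   : ∀ R S T → (R ∪ S) ∪ T ≡ R ∪ (S ∪ T)
    ∪-comm    : ∀ R S → R ∪ S ≡ S ∪ R
    huntington : ∀ R S → R ≡ ∁ (∁ R ∪ ∁ S) ∪ ∁ (∁ R ∪ S)
    ⨾-assoc   : ∀ R S T → (R ⨾ S) ⨾ T ≡ R ⨾ (S ⨾ T)
    ⨾-distribʳ : ∀ R S T → (R ∪ S) ⨾ T ≡ R ⨾ T ∪ S ⨾ T
    ⨾-identityʳ : ∀ R → R ⨾ I ≡ R
    ᵀ-involutive : ∀ R → (R ᵀ) ᵀ ≡ R
    ᵀ-∪ : ∀ R S → (R ∪ S) ᵀ ≡ R ᵀ ∪ S ᵀ
    ᵀ-⨾ : ∀ R S → (R ⨾ S) ᵀ ≡ S ᵀ ⨾ R ᵀ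
    schroeder : ∀ R S → R ᵀ ⨾ ∁ (R ⨾ S) ∪ ∁ S ≡ ∁ S
    star-unfoldˡ : ∀ R → I ∪ R ⨾ R * ⊆ R *
    star-unfoldʳ : ∀ R → I ∪ R * ⨾ R ⊆ R *
    star-inductˡ : ∀ R S Q → S ∪ R ⨾ Q ⊆ Q → R * ⨾ S ⊆ Q
    star-inductʳ : ∀ R S Q → S ∪ Q ⨾ R ⊆ Q → S ⨾ R * ⊆ Q

  IsPoint : B → Set ℓ
  IsPoint p = (p ≡ p ⨾ L) × (p ⨾ p ᵀ ⊆ I) × (I ⊆ p ᵀ ⨾ p)

  field
    tarski : ∀ R → (¬ (R ≡ O) → L ⨾ R ⨾ L ≡ L) × (L ⨾ R ⨾ L ≡ L → ¬ (R ≡ O))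
    point-axiom : ∀ R → ¬ (R ≡ O) →
      Σ B λ p → Σ B λ q → IsPoint p × IsPoint q × (p ⨾ q ᵀ ⊆ R)

  Univalent : B → Set ℓ
  Univalent R = R ᵀ ⨾ R ⊆ I

  Injective : B → Set ℓ
  Injective R = R ⨾ R ᵀ ⊆ I

  Connected : B → Set ℓ
  Connected R = R ⨾ L ⨾ R ⊆ R * ∪ (R ᵀ) *

  IsPath : B → Set ℓ
  IsPath R = Injective R × Univalent R × Connected R

-- For injective univalent R, reach R = R* ∪ (Rᵀ)* is symmetric and transitive: a mixed
-- product (Rᵀ)* ⨾ R* straightens out because Rᵀ ⨾ R ⊆ I, and R* ⨾ (Rᵀ)* because R ⨾ Rᵀ ⊆ I.
-- Given a point p with p ⨾ R ⊆ reach R, the inclusions R ⊆ R ⨾ Rᵀ ⨾ R and L ⊆ pᵀ ⨾ p give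
-- R ⨾ L ⨾ R ⊆ R ⨾ (p ⨾ R)ᵀ ⨾ (p ⨾ R) ⊆ reach R. Conversely, the point axiom yields a point
-- p ⊆ R ⨾ L (any point if R = O); then p ⨾ R ⊆ R ⨾ L ⨾ R ⊆ reach R by connectedness.
module Submission where

open import Defs
open import Level using (Level)
open import Data.Product using (Σ; _×_; _,_; proj₂)
open import Function.Bundles using (_⇔_; mk⇔)
open import Relation.Nullary using (¬_)
open import Relation.Binary.Bundles using (Poset)
open import Relation.Binary.PropositionalEquality
  using (_≡_; refl; sym; trans; cong; cong₂; subst; isEquivalence; module ≡-Reasoning)
open import Algebra.Bundles using (CommutativeSemigroup)
import Algebra.Properties.CommutativeSemigroup as CommutativeSemigroupProperties
import Relation.Binary.Reasoning.PartialOrder as PartialOrderReasoning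

module _ {ℓ : Level} (K : KleeneRelationAlgebra ℓ) where
  open KleeneRelationAlgebra K

  variable
    p q x y z w : B

  ∪-commutativeSemigroup : CommutativeSemigroup ℓ ℓ
  ∪-commutativeSemigroup = record
    { _≈_ = _≡_
    ; _∙_ = _∪_
    ; isCommutativeSemigroup = record
      { isSemigroup = record
        { isMagma = record { isEquivalence = isEquivalence ; ∙-cong = cong₂ _∪_ }
        ; assoc = ∪-assoc
        }
      ; comm = ∪-comm
      }
    }

  open CommutativeSemigroupProperties ∪-commutativeSemigroup
    using (x∙yz≈y∙xz; interchange)

  -- Boolean algebra from Huntington's axiom

  x∪∁x≡y∪∁y : ∀ x y → x ∪ ∁ x ≡ y ∪ ∁ y
  x∪∁x≡y∪∁y x y = begin
      x ∪ ∁ x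
    ≡⟨ cong₂ _∪_ (huntington x (∁ y)) (huntington (∁ x) (∁ y)) ⟩
      (a ∪ b) ∪ (c ∪ d)
    ≡⟨ interchange a b c d ⟩
      (a ∪ c) ∪ (b ∪ d)
    ≡⟨ ∪-comm _ _ ⟩
      (b ∪ d) ∪ (a ∪ c)
    ≡⟨ cong₂ _∪_ (∪-comm b d) (∪-comm a c) ⟩
      (d ∪ b) ∪ (c ∪ a)
    ≡⟨ cong₂ _∪_ (cong₂ _∪_ (∁-comm _ _) (∁-comm _ _)) (cong₂ _∪_ (∁-comm _ _) (∁-comm _ _)) ⟩
      (∁ (∁ y ∪ ∁ (∁ x)) ∪ ∁ (∁ y ∪ ∁ x)) ∪ (∁ (∁ (∁ y) ∪ ∁ (∁ x)) ∪ ∁ (∁ (∁ y) ∪ ∁ x))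
    ≡⟨ cong₂ _∪_ (huntington y (∁ x)) (huntington (∁ y) (∁ x)) ⟨
      y ∪ ∁ y ∎
    where
      open ≡-Reasoning
      a b c d : B
      a = ∁ (∁ x ∪ ∁ (∁ y))
      b = ∁ (∁ x ∪ ∁ y)
      c = ∁ (∁ (∁ x) ∪ ∁ (∁ y))
      d = ∁ (∁ (∁ x) ∪ ∁ y)
      ∁-comm : ∀ u v → ∁ (u ∪ v) ≡ ∁ (v ∪ u)
      ∁-comm u v = cong ∁_ (∪-comm u v)

  x∪∁x≡L : ∀ x → x ∪ ∁ x ≡ L
  x∪∁x≡L x = x∪∁x≡y∪∁y x I

  ∁x∪x≡L : ∀ x → ∁ x ∪ x ≡ L
  ∁x∪x≡L x = trans (∪-comm (∁ x) x) (x∪∁x≡L x)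

  ∁-involutive : ∀ x → ∁ (∁ x) ≡ x
  ∁-involutive x = begin
      ∁ (∁ x)
    ≡⟨ huntington (∁ (∁ x)) (∁ x) ⟩
      ∁ (∁ (∁ (∁ x)) ∪ ∁ (∁ x)) ∪ ∁ (∁ (∁ (∁ x)) ∪ ∁ x)
    ≡⟨ cong (λ t → ∁ t ∪ ∁ (∁ (∁ (∁ x)) ∪ ∁ x)) (∁x∪x≡L (∁ (∁ x))) ⟩
      ∁ L ∪ ∁ (∁ (∁ (∁ x)) ∪ ∁ x)
    ≡⟨ ∪-comm _ _ ⟩
      ∁ (∁ (∁ (∁ x)) ∪ ∁ x) ∪ ∁ L
    ≡⟨ cong₂ (λ a b → ∁ a ∪ ∁ b) (∪-comm _ _) (x∪∁x≡L (∁ x)) ⟨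
      ∁ (∁ x ∪ ∁ (∁ (∁ x))) ∪ ∁ (∁ x ∪ ∁ (∁ x))
    ≡⟨ huntington x (∁ (∁ x)) ⟨
      x ∎
    where open ≡-Reasoning

  x≡x∩x∪∁L : ∀ x → x ≡ x ∩ x ∪ ∁ L
  x≡x∩x∪∁L x = trans (huntington x x) (cong (λ t → x ∩ x ∪ ∁ t) (∁x∪x≡L x))

  ∁L∪∁L≡∁L : ∁ L ∪ ∁ L ≡ ∁ L
  ∁L∪∁L≡∁L = begin
      ∁ L ∪ ∁ L
    ≡⟨ huntington (∁ L ∪ ∁ L) (∁ L) ⟩
      ∁ (L ∩ L ∪ ∁ (∁ L)) ∪ ∁ (L ∩ L ∪ ∁ L)
    ≡⟨ cong₂ (λ a b → ∁ (L ∩ L ∪ a) ∪ ∁ b) (∁-involutive L) (sym (x≡x∩x∪∁L L)) ⟩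
      ∁ (L ∩ L ∪ L) ∪ ∁ L
    ≡⟨ cong (λ t → ∁ t ∪ ∁ L) L∩L∪L≡L∪L ⟩
      ∁ (L ∪ L) ∪ ∁ L
    ≡⟨ cong (λ t → ∁ (t ∪ t) ∪ ∁ L) (∁-involutive L) ⟨
      ∁ L ∩ ∁ L ∪ ∁ L
    ≡⟨ x≡x∩x∪∁L (∁ L) ⟨
      ∁ L ∎
    where
      open ≡-Reasoning
      L∩L∪L≡L∪L : L ∩ L ∪ L ≡ L ∪ L
      L∩L∪L≡L∪L = begin
          L ∩ L ∪ L              ≡⟨ cong (L ∩ L ∪_) (x∪∁x≡L L) ⟨
          L ∩ L ∪ (L ∪ ∁ L)      ≡⟨ x∙yz≈y∙xz (L ∩ L) L (∁ L) ⟩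
          L ∪ (L ∩ L ∪ ∁ L)      ≡⟨ cong (L ∪_) (x≡x∩x∪∁L L) ⟨
          L ∪ L                  ∎

  ∪-identityʳ-∁L : ∀ x → x ∪ ∁ L ≡ x
  ∪-identityʳ-∁L x = begin
      x ∪ ∁ L                  ≡⟨ cong (_∪ ∁ L) (x≡x∩x∪∁L x) ⟩
      (x ∩ x ∪ ∁ L) ∪ ∁ L      ≡⟨ ∪-assoc _ _ _ ⟩
      x ∩ x ∪ (∁ L ∪ ∁ L)      ≡⟨ cong (x ∩ x ∪_) ∁L∪∁L≡∁L ⟩
      x ∩ x ∪ ∁ L              ≡⟨ x≡x∩x∪∁L x ⟨
      x                        ∎
    where open ≡-Reasoning

  ∩-idem : ∀ x → x ∩ x ≡ x
  ∩-idem x = sym (trans (x≡x∩x∪∁L x) (∪-identityʳ-∁L (x ∩ x)))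

  ∪-idem : ∀ x → x ∪ x ≡ x
  ∪-idem x = begin
      x ∪ x            ≡⟨ ∁-involutive (x ∪ x) ⟨
      ∁ (∁ (x ∪ x))    ≡⟨ cong (λ t → ∁ (∁ (t ∪ t))) (∁-involutive x) ⟨
      ∁ (∁ x ∩ ∁ x)    ≡⟨ cong ∁_ (∩-idem (∁ x)) ⟩
      ∁ (∁ x)          ≡⟨ ∁-involutive x ⟩
      x                ∎
    where open ≡-Reasoning

  O≡∁L : O ≡ ∁ L
  O≡∁L = trans (cong (λ t → ∁ (∁ I ∪ t)) (∁-involutive I)) (cong ∁_ (∪-comm (∁ I) I))

  ⊆-reflexive : x ≡ y → x ⊆ y
  ⊆-reflexive {x} refl = ∪-idem x

  ⊆-refl : x ⊆ x
  ⊆-refl = ⊆-reflexive refl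

  ⊆-trans : x ⊆ y → y ⊆ z → x ⊆ z
  ⊆-trans {x} {y} {z} x⊆y y⊆z = begin
      x ∪ z          ≡⟨ cong (x ∪_) y⊆z ⟨
      x ∪ (y ∪ z)    ≡⟨ ∪-assoc x y z ⟨
      (x ∪ y) ∪ z    ≡⟨ cong (_∪ z) x⊆y ⟩
      y ∪ z          ≡⟨ y⊆z ⟩
      z              ∎
    where open ≡-Reasoning

  ⊆-antisym : x ⊆ y → y ⊆ x → x ≡ y
  ⊆-antisym {x} {y} x⊆y y⊆x = trans (sym y⊆x) (trans (∪-comm y x) x⊆y)

  ⊆-poset : Poset ℓ ℓ ℓ
  ⊆-poset = record
    { _≈_ = _≡_
    ; _≤_ = _⊆_
    ; isPartialOrder = record
      { isPreorder = record
        { isEquivalence = isEquivalence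
        ; reflexive = ⊆-reflexive
        ; trans = ⊆-trans
        }
      ; antisym = ⊆-antisym
      }
    }

  module ⊆-Reasoning = PartialOrderReasoning ⊆-poset

  x⊆x∪y : ∀ x y → x ⊆ x ∪ y
  x⊆x∪y x y = trans (sym (∪-assoc x x y)) (cong (_∪ y) (∪-idem x))

  y⊆x∪y : ∀ x y → y ⊆ x ∪ y
  y⊆x∪y x y = trans (x∙yz≈y∙xz y x y) (cong (x ∪_) (∪-idem y))

  ∪-least : x ⊆ z → y ⊆ z → x ∪ y ⊆ z
  ∪-least {x} {z} {y} x⊆z y⊆z = trans (∪-assoc x y z) (trans (cong (x ∪_) y⊆z) x⊆z)

  ∪-mono : x ⊆ y → z ⊆ w → x ∪ z ⊆ y ∪ w
  ∪-mono {y = y} {w = w} x⊆y z⊆w = ∪-least (⊆-trans x⊆y (x⊆x∪y y w)) (⊆-trans z⊆w (y⊆x∪y y w))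

  x⊆L : ∀ x → x ⊆ L
  x⊆L x = begin
      x ∪ L            ≡⟨ cong (x ∪_) (x∪∁x≡L x) ⟨
      x ∪ (x ∪ ∁ x)    ≡⟨ ∪-assoc x x (∁ x) ⟨
      (x ∪ x) ∪ ∁ x    ≡⟨ cong (_∪ ∁ x) (∪-idem x) ⟩
      x ∪ ∁ x          ≡⟨ x∪∁x≡L x ⟩
      L                ∎
    where open ≡-Reasoning

  O⊆x : ∀ x → O ⊆ x
  O⊆x x = trans (cong (_∪ x) O≡∁L) (trans (∪-comm (∁ L) x) (∪-identityʳ-∁L x))

  ⊆O⇒≡O : x ⊆ O → x ≡ O
  ⊆O⇒≡O {x} x⊆O = ⊆-antisym x⊆O (O⊆x x)

  ∁-antitone : x ⊆ y → ∁ y ⊆ ∁ x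
  ∁-antitone {x} {y} x⊆y = begin
      ∁ y ∪ ∁ x          ≡⟨ cong (∁ y ∪_) ∁x≡d∪∁y ⟩
      ∁ y ∪ (d ∪ ∁ y)    ≡⟨ x∙yz≈y∙xz (∁ y) d (∁ y) ⟩
      d ∪ (∁ y ∪ ∁ y)    ≡⟨ cong (d ∪_) (∪-idem (∁ y)) ⟩
      d ∪ ∁ y            ≡⟨ ∁x≡d∪∁y ⟨
      ∁ x                ∎
    where
      open ≡-Reasoning
      d : B
      d = ∁ (x ∪ ∁ y)
      ∁x≡d∪∁y : ∁ x ≡ d ∪ ∁ y
      ∁x≡d∪∁y = trans (huntington (∁ x) y)
                      (cong₂ (λ a b → ∁ (a ∪ ∁ y) ∪ ∁ b) (∁-involutive x)
                             (trans (cong (_∪ y) (∁-involutive x)) x⊆y))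

  ∩-lowerʳ : ∀ x y → x ∩ y ⊆ y
  ∩-lowerʳ x y = subst (x ∩ y ⊆_) (∁-involutive y) (∁-antitone (y⊆x∪y (∁ x) (∁ y)))

  ∁≡O⇒≡L : ∁ x ≡ O → x ≡ L
  ∁≡O⇒≡L {x} ∁x≡O = begin
      x          ≡⟨ ∁-involutive x ⟨
      ∁ (∁ x)    ≡⟨ cong ∁_ (trans ∁x≡O O≡∁L) ⟩
      ∁ (∁ L)    ≡⟨ ∁-involutive L ⟩
      L          ∎
    where open ≡-Reasoning

  ⊆-∁-disjoint : w ⊆ x → w ⊆ ∁ x → w ≡ O
  ⊆-∁-disjoint {w} {x} w⊆x w⊆∁x = begin
      w          ≡⟨ ∁-involutive w ⟨
      ∁ (∁ w)    ≡⟨ cong ∁_ ∁w≡L ⟩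
      ∁ L        ≡⟨ O≡∁L ⟨
      O          ∎
    where
      open ≡-Reasoning
      w⊆∁w : w ⊆ ∁ w
      w⊆∁w = ⊆-trans w⊆x (subst (_⊆ ∁ w) (∁-involutive x) (∁-antitone w⊆∁x))
      ∁w≡L : ∁ w ≡ L
      ∁w≡L = trans (sym w⊆∁w) (x∪∁x≡L w)

  ⊆∪∁⇒⊆ : x ⊆ y ∪ ∁ x → x ⊆ y
  ⊆∪∁⇒⊆ {x} {y} x⊆y∪∁x = subst (_⊆ y) (sym x≡x∩y) (∩-lowerʳ x y)
    where
      d : B
      d = ∁ (∁ x ∪ y)
      d≡O : d ≡ O
      d≡O = ⊆-∁-disjoint
        (subst (d ⊆_) (∁-involutive x) (∁-antitone (x⊆x∪y (∁ x) y)))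
        (subst (λ t → ∁ t ⊆ ∁ x) (∪-comm y (∁ x)) (∁-antitone x⊆y∪∁x))
      x≡x∩y : x ≡ x ∩ y
      x≡x∩y = trans (huntington x y)
                    (trans (cong (x ∩ y ∪_) (trans d≡O O≡∁L)) (∪-identityʳ-∁L (x ∩ y)))

  -- Composition and converse

  ᵀ-mono : x ⊆ y → x ᵀ ⊆ y ᵀ
  ᵀ-mono {x} {y} x⊆y = trans (sym (ᵀ-∪ x y)) (cong _ᵀ x⊆y)

  ᵀ-⨾ᵀ : ∀ x y → (x ᵀ ⨾ y ᵀ) ᵀ ≡ y ⨾ x
  ᵀ-⨾ᵀ x y = trans (ᵀ-⨾ (x ᵀ) (y ᵀ)) (cong₂ _⨾_ (ᵀ-involutive y) (ᵀ-involutive x))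

  ⨾-distribˡ : ∀ x y z → x ⨾ (y ∪ z) ≡ x ⨾ y ∪ x ⨾ z
  ⨾-distribˡ x y z = begin
      x ⨾ (y ∪ z)                      ≡⟨ ᵀ-⨾ᵀ (y ∪ z) x ⟨
      ((y ∪ z) ᵀ ⨾ x ᵀ) ᵀ              ≡⟨ cong (λ t → (t ⨾ x ᵀ) ᵀ) (ᵀ-∪ y z) ⟩
      ((y ᵀ ∪ z ᵀ) ⨾ x ᵀ) ᵀ            ≡⟨ cong _ᵀ (⨾-distribʳ (y ᵀ) (z ᵀ) (x ᵀ)) ⟩
      (y ᵀ ⨾ x ᵀ ∪ z ᵀ ⨾ x ᵀ) ᵀ        ≡⟨ ᵀ-∪ _ _ ⟩
      (y ᵀ ⨾ x ᵀ) ᵀ ∪ (z ᵀ ⨾ x ᵀ) ᵀ    ≡⟨ cong₂ _∪_ (ᵀ-⨾ᵀ y x) (ᵀ-⨾ᵀ z x) ⟩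
      x ⨾ y ∪ x ⨾ z                    ∎
    where open ≡-Reasoning

  ⨾-monoˡ : ∀ z → x ⊆ y → x ⨾ z ⊆ y ⨾ z
  ⨾-monoˡ {x} {y} z x⊆y = trans (sym (⨾-distribʳ x y z)) (cong (_⨾ z) x⊆y)

  ⨾-monoʳ : ∀ z → x ⊆ y → z ⨾ x ⊆ z ⨾ y
  ⨾-monoʳ {x} {y} z x⊆y = trans (sym (⨾-distribˡ z x y)) (cong (z ⨾_) x⊆y)

  ⨾-mono : x ⊆ y → z ⊆ w → x ⨾ z ⊆ y ⨾ w
  ⨾-mono {y = y} {z = z} x⊆y z⊆w = ⊆-trans (⨾-monoˡ z x⊆y) (⨾-monoʳ y z⊆w)

  ᵀ-I : I ᵀ ≡ I
  ᵀ-I = begin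
      I ᵀ                ≡⟨ ⨾-identityʳ (I ᵀ) ⟨
      I ᵀ ⨾ I            ≡⟨ cong (I ᵀ ⨾_) (ᵀ-involutive I) ⟨
      I ᵀ ⨾ (I ᵀ) ᵀ      ≡⟨ ᵀ-⨾ (I ᵀ) I ⟨
      (I ᵀ ⨾ I) ᵀ        ≡⟨ cong _ᵀ (⨾-identityʳ (I ᵀ)) ⟩
      (I ᵀ) ᵀ            ≡⟨ ᵀ-involutive I ⟩
      I                  ∎
    where open ≡-Reasoning

  ⨾-identityˡ : ∀ x → I ⨾ x ≡ x
  ⨾-identityˡ x = begin
      I ⨾ x              ≡⟨ ᵀ-⨾ᵀ x I ⟨
      (x ᵀ ⨾ I ᵀ) ᵀ      ≡⟨ cong (λ t → (x ᵀ ⨾ t) ᵀ) ᵀ-I ⟩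
      (x ᵀ ⨾ I) ᵀ        ≡⟨ cong _ᵀ (⨾-identityʳ (x ᵀ)) ⟩
      (x ᵀ) ᵀ            ≡⟨ ᵀ-involutive x ⟩
      x                  ∎
    where open ≡-Reasoning

  ᵀ-O : O ᵀ ≡ O
  ᵀ-O = ⊆O⇒≡O (subst (O ᵀ ⊆_) (ᵀ-involutive O) (ᵀ-mono (O⊆x (O ᵀ))))

  x⊆x⨾L : ∀ x → x ⊆ x ⨾ L
  x⊆x⨾L x = subst (_⊆ x ⨾ L) (⨾-identityʳ x) (⨾-monoʳ x (x⊆L I))

  x⨾L⨾y⊆L⨾y : ∀ x y → x ⨾ L ⨾ y ⊆ L ⨾ y
  x⨾L⨾y⊆L⨾y x y = subst (_⊆ L ⨾ y) (⨾-assoc x L y) (⨾-monoˡ y (x⊆L (x ⨾ L)))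

  -- By Schröder, x ⨾ ∁ (x ᵀ ⨾ x) ⊆ ∁ x: the part of x ⨾ L outside x ⨾ x ᵀ ⨾ x misses x.
  x⊆x⨾xᵀ⨾x : ∀ x → x ⊆ x ⨾ x ᵀ ⨾ x
  x⊆x⨾xᵀ⨾x x = ⊆∪∁⇒⊆ (begin
      x                          ≤⟨ x⊆x⨾L x ⟩
      x ⨾ L                      ≡⟨ cong (x ⨾_) (x∪∁x≡L (x ᵀ ⨾ x)) ⟨
      x ⨾ (t ∪ ∁ t)              ≡⟨ ⨾-distribˡ x t (∁ t) ⟩
      x ⨾ t ∪ x ⨾ ∁ t            ≤⟨ ∪-mono ⊆-refl x⨾∁t⊆∁x ⟩
      x ⨾ t ∪ ∁ x                ∎)
    where
      open ⊆-Reasoning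
      t : B
      t = x ᵀ ⨾ x
      x⨾∁t⊆∁x : x ⨾ ∁ t ⊆ ∁ x
      x⨾∁t⊆∁x = subst (λ u → u ⨾ ∁ t ⊆ ∁ x) (ᵀ-involutive x) (schroeder (x ᵀ) x)

  -- Kleene star

  I⊆* : ∀ x → I ⊆ x *
  I⊆* x = ⊆-trans (x⊆x∪y I (x ⨾ x *)) (star-unfoldˡ x)

  x⨾x*⊆x* : ∀ x → x ⨾ x * ⊆ x *
  x⨾x*⊆x* x = ⊆-trans (y⊆x∪y I (x ⨾ x *)) (star-unfoldˡ x)

  x⊆x* : ∀ x → x ⊆ x *
  x⊆x* x = subst (_⊆ x *) (⨾-identityʳ x) (⊆-trans (⨾-monoʳ x (I⊆* x)) (x⨾x*⊆x* x))

  x*⨾x*⊆x* : ∀ x → x * ⨾ x * ⊆ x *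
  x*⨾x*⊆x* x = star-inductˡ x (x *) (x *) (∪-least ⊆-refl (x⨾x*⊆x* x))

  x*⊆I∪x⨾x* : ∀ x → x * ⊆ I ∪ x ⨾ x *
  x*⊆I∪x⨾x* x = subst (_⊆ I ∪ x ⨾ x *) (⨾-identityʳ (x *))
    (star-inductˡ x I (I ∪ x ⨾ x *) (∪-mono ⊆-refl (begin
      x ⨾ (I ∪ x ⨾ x *)          ≡⟨ ⨾-distribˡ x I (x ⨾ x *) ⟩
      x ⨾ I ∪ x ⨾ x ⨾ x *        ≤⟨ ∪-least (⨾-monoʳ x (I⊆* x)) (⨾-monoʳ x (x⨾x*⊆x* x)) ⟩
      x ⨾ x *                    ∎)))
    where open ⊆-Reasoning

  x*ᵀ⊆xᵀ* : ∀ x → (x *) ᵀ ⊆ (x ᵀ) *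
  x*ᵀ⊆xᵀ* x = subst ((x *) ᵀ ⊆_) (ᵀ-involutive ((x ᵀ) *)) (ᵀ-mono x*⊆xᵀ*ᵀ)
    where
      x*⊆xᵀ*ᵀ : x * ⊆ ((x ᵀ) *) ᵀ
      x*⊆xᵀ*ᵀ = subst (_⊆ ((x ᵀ) *) ᵀ) (⨾-identityʳ (x *))
        (star-inductˡ x I (((x ᵀ) *) ᵀ) (begin
          I ∪ x ⨾ ((x ᵀ) *) ᵀ              ≡⟨ cong₂ _∪_ ᵀ-I (cong (_⨾ ((x ᵀ) *) ᵀ) (ᵀ-involutive x)) ⟨
          I ᵀ ∪ ((x ᵀ) ᵀ) ⨾ ((x ᵀ) *) ᵀ    ≡⟨ cong (I ᵀ ∪_) (ᵀ-⨾ ((x ᵀ) *) (x ᵀ)) ⟨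
          I ᵀ ∪ ((x ᵀ) * ⨾ x ᵀ) ᵀ          ≡⟨ ᵀ-∪ I ((x ᵀ) * ⨾ x ᵀ) ⟨
          (I ∪ (x ᵀ) * ⨾ x ᵀ) ᵀ            ≤⟨ ᵀ-mono (star-unfoldʳ (x ᵀ)) ⟩
          ((x ᵀ) *) ᵀ                      ∎))
        where open ⊆-Reasoning

  -- Paths

  reach : B → B
  reach x = x * ∪ (x ᵀ) *

  x⊆reach : ∀ x → x ⊆ reach x
  x⊆reach x = ⊆-trans (x⊆x* x) (x⊆x∪y (x *) ((x ᵀ) *))

  reach-ᵀ : ∀ x → reach (x ᵀ) ≡ reach x
  reach-ᵀ x = trans (cong (λ t → (x ᵀ) * ∪ t *) (ᵀ-involutive x)) (∪-comm ((x ᵀ) *) (x *))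

  reachᵀ⊆reach : ∀ x → (reach x) ᵀ ⊆ reach x
  reachᵀ⊆reach x = begin
      (x * ∪ (x ᵀ) *) ᵀ          ≡⟨ ᵀ-∪ (x *) ((x ᵀ) *) ⟩
      (x *) ᵀ ∪ ((x ᵀ) *) ᵀ      ≤⟨ ∪-mono (x*ᵀ⊆xᵀ* x) (x*ᵀ⊆xᵀ* (x ᵀ)) ⟩
      reach (x ᵀ)                ≡⟨ reach-ᵀ x ⟩
      reach x                    ∎
    where open ⊆-Reasoning

  univalent⇒xᵀ*⨾x*⊆reach : Univalent x → (x ᵀ) * ⨾ x * ⊆ reach x
  univalent⇒xᵀ*⨾x*⊆reach {x} univalent =
    star-inductˡ (x ᵀ) (x *) (reach x) (∪-least (x⊆x∪y (x *) ((x ᵀ) *)) xᵀ⨾reach⊆reach)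
    where
      open ⊆-Reasoning
      xᵀ⨾x*⊆reach : x ᵀ ⨾ x * ⊆ reach x
      xᵀ⨾x*⊆reach = begin
        x ᵀ ⨾ x *                       ≤⟨ ⨾-monoʳ (x ᵀ) (x*⊆I∪x⨾x* x) ⟩
        x ᵀ ⨾ (I ∪ x ⨾ x *)             ≡⟨ ⨾-distribˡ (x ᵀ) I (x ⨾ x *) ⟩
        x ᵀ ⨾ I ∪ x ᵀ ⨾ x ⨾ x *         ≡⟨ cong₂ _∪_ (⨾-identityʳ (x ᵀ)) (sym (⨾-assoc (x ᵀ) x (x *))) ⟩
        x ᵀ ∪ (x ᵀ ⨾ x) ⨾ x *           ≤⟨ ∪-mono (x⊆x* (x ᵀ)) (⨾-monoˡ (x *) univalent) ⟩
        (x ᵀ) * ∪ I ⨾ x *               ≡⟨ cong ((x ᵀ) * ∪_) (⨾-identityˡ (x *)) ⟩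
        (x ᵀ) * ∪ x *                   ≡⟨ ∪-comm ((x ᵀ) *) (x *) ⟩
        reach x                         ∎
      xᵀ⨾reach⊆reach : x ᵀ ⨾ reach x ⊆ reach x
      xᵀ⨾reach⊆reach = begin
        x ᵀ ⨾ (x * ∪ (x ᵀ) *)           ≡⟨ ⨾-distribˡ (x ᵀ) (x *) ((x ᵀ) *) ⟩
        x ᵀ ⨾ x * ∪ x ᵀ ⨾ (x ᵀ) *       ≤⟨ ∪-least xᵀ⨾x*⊆reach (⊆-trans (x⨾x*⊆x* (x ᵀ)) (y⊆x∪y (x *) ((x ᵀ) *))) ⟩
        reach x                         ∎

  injective⇒x*⨾xᵀ*⊆reach : Injective x → x * ⨾ (x ᵀ) * ⊆ reach x
  injective⇒x*⨾xᵀ*⊆reach {x} injective = begin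
      x * ⨾ (x ᵀ) *                 ≡⟨ cong (λ t → t * ⨾ (x ᵀ) *) (ᵀ-involutive x) ⟨
      ((x ᵀ) ᵀ) * ⨾ (x ᵀ) *         ≤⟨ univalent⇒xᵀ*⨾x*⊆reach xᵀ-univalent ⟩
      reach (x ᵀ)                   ≡⟨ reach-ᵀ x ⟩
      reach x                       ∎
    where
      open ⊆-Reasoning
      xᵀ-univalent : Univalent (x ᵀ)
      xᵀ-univalent = subst (λ t → t ⨾ x ᵀ ⊆ I) (sym (ᵀ-involutive x)) injective

  reach⨾reach⊆reach : Injective x → Univalent x → reach x ⨾ reach x ⊆ reach x
  reach⨾reach⊆reach {x} injective univalent = begin
      (x * ∪ (x ᵀ) *) ⨾ (x * ∪ (x ᵀ) *)
    ≡⟨ trans (⨾-distribʳ _ _ _) (cong₂ _∪_ (⨾-distribˡ _ _ _) (⨾-distribˡ _ _ _)) ⟩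
      (x * ⨾ x * ∪ x * ⨾ (x ᵀ) *) ∪ ((x ᵀ) * ⨾ x * ∪ (x ᵀ) * ⨾ (x ᵀ) *)
    ≤⟨ ∪-least (∪-least (⊆-trans (x*⨾x*⊆x* x) (x⊆x∪y _ _)) (injective⇒x*⨾xᵀ*⊆reach injective))
               (∪-least (univalent⇒xᵀ*⨾x*⊆reach univalent) (⊆-trans (x*⨾x*⊆x* (x ᵀ)) (y⊆x∪y _ _))) ⟩
      reach x
    ∎
    where open ⊆-Reasoning

  L⊆pᵀ⨾p : p ≡ p ⨾ L → I ⊆ p ᵀ ⨾ p → L ⊆ p ᵀ ⨾ p
  L⊆pᵀ⨾p {p} p≡p⨾L I⊆pᵀ⨾p = begin
      L                  ≡⟨ ⨾-identityˡ L ⟨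
      I ⨾ L              ≤⟨ ⨾-monoˡ L I⊆pᵀ⨾p ⟩
      (p ᵀ ⨾ p) ⨾ L      ≡⟨ ⨾-assoc (p ᵀ) p L ⟩
      p ᵀ ⨾ p ⨾ L        ≡⟨ cong (p ᵀ ⨾_) p≡p⨾L ⟨
      p ᵀ ⨾ p            ∎
    where open ⊆-Reasoning

  x⨾qᵀ⊆y⇒x⊆y⨾L : I ⊆ q ᵀ ⨾ q → x ⨾ q ᵀ ⊆ y → x ⊆ y ⨾ L
  x⨾qᵀ⊆y⇒x⊆y⨾L {q} {x} {y} I⊆qᵀ⨾q x⨾qᵀ⊆y = begin
      x                  ≡⟨ ⨾-identityʳ x ⟨
      x ⨾ I              ≤⟨ ⨾-monoʳ x I⊆qᵀ⨾q ⟩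
      x ⨾ q ᵀ ⨾ q        ≡⟨ ⨾-assoc x (q ᵀ) q ⟨
      (x ⨾ q ᵀ) ⨾ q      ≤⟨ ⨾-mono x⨾qᵀ⊆y (x⊆L q) ⟩
      y ⨾ L              ∎
    where open ⊆-Reasoning

  point⇒connected : Injective x → Univalent x → IsPoint p → p ⨾ x ⊆ reach x → Connected x
  point⇒connected {x} {p} injective univalent (p≡p⨾L , _ , I⊆pᵀ⨾p) p⨾x⊆reach = begin
      x ⨾ L ⨾ x                    ≤⟨ ⨾-monoˡ (L ⨾ x) (x⊆x⨾xᵀ⨾x x) ⟩
      (x ⨾ x ᵀ ⨾ x) ⨾ L ⨾ x        ≡⟨ trans (⨾-assoc x _ _) (cong (x ⨾_) (⨾-assoc (x ᵀ) x _)) ⟩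
      x ⨾ x ᵀ ⨾ x ⨾ L ⨾ x          ≤⟨ ⨾-monoʳ x (⨾-monoʳ (x ᵀ) (x⨾L⨾y⊆L⨾y x x)) ⟩
      x ⨾ x ᵀ ⨾ L ⨾ x              ≤⟨ ⨾-monoʳ x (⨾-monoʳ (x ᵀ) (⨾-monoˡ x (L⊆pᵀ⨾p p≡p⨾L I⊆pᵀ⨾p))) ⟩
      x ⨾ x ᵀ ⨾ (p ᵀ ⨾ p) ⨾ x      ≡⟨ cong (x ⨾_) xᵀ⨾pᵀ⨾p⨾x≡[p⨾x]ᵀ⨾p⨾x ⟩
      x ⨾ (p ⨾ x) ᵀ ⨾ p ⨾ x        ≤⟨ ⨾-monoʳ x (⨾-mono (⊆-trans (ᵀ-mono p⨾x⊆reach) (reachᵀ⊆reach x)) p⨾x⊆reach) ⟩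
      x ⨾ reach x ⨾ reach x        ≤⟨ ⨾-mono (x⊆reach x) (reach⨾reach⊆reach injective univalent) ⟩
      reach x ⨾ reach x            ≤⟨ reach⨾reach⊆reach injective univalent ⟩
      reach x                      ∎
    where
      open ⊆-Reasoning
      xᵀ⨾pᵀ⨾p⨾x≡[p⨾x]ᵀ⨾p⨾x : x ᵀ ⨾ (p ᵀ ⨾ p) ⨾ x ≡ (p ⨾ x) ᵀ ⨾ p ⨾ x
      xᵀ⨾pᵀ⨾p⨾x≡[p⨾x]ᵀ⨾p⨾x = trans (cong (x ᵀ ⨾_) (⨾-assoc (p ᵀ) p x))
                                (trans (sym (⨾-assoc (x ᵀ) (p ᵀ) (p ⨾ x)))
                                       (cong (_⨾ p ⨾ x) (sym (ᵀ-⨾ p x))))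

  -- It is x ⨾ L when x ≠ O and L when x = O; either way it is nonzero,
  -- which yields a point without having to decide x ≡ O.
  domain⁺ : B → B
  domain⁺ x = x ⨾ L ∪ (∁ (L ⨾ x ⨾ L)) ᵀ

  domain⁺≢O : ∀ x → ¬ (domain⁺ x ≡ O)
  domain⁺≢O x domain⁺≡O = proj₂ (tarski x) L⨾x⨾L≡L x≡O
    where
      open ⊆-Reasoning
      x≡O : x ≡ O
      x≡O = ⊆O⇒≡O (begin
        x              ≤⟨ x⊆x⨾L x ⟩
        x ⨾ L          ≤⟨ x⊆x∪y (x ⨾ L) _ ⟩
        domain⁺ x      ≡⟨ domain⁺≡O ⟩
        O              ∎)
      L⨾x⨾L≡L : L ⨾ x ⨾ L ≡ L
      L⨾x⨾L≡L = ∁≡O⇒≡L (⊆O⇒≡O (begin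
        ∁ (L ⨾ x ⨾ L)              ≡⟨ ᵀ-involutive _ ⟨
        ((∁ (L ⨾ x ⨾ L)) ᵀ) ᵀ      ≤⟨ ᵀ-mono (y⊆x∪y (x ⨾ L) _) ⟩
        (domain⁺ x) ᵀ              ≡⟨ cong _ᵀ domain⁺≡O ⟩
        O ᵀ                        ≡⟨ ᵀ-O ⟩
        O                          ∎))

  ∁[L⨾x⨾L]ᵀ⨾L⨾x≡O : ∀ x → (∁ (L ⨾ x ⨾ L)) ᵀ ⨾ L ⨾ x ≡ O
  ∁[L⨾x⨾L]ᵀ⨾L⨾x≡O x = ⊆O⇒≡O (begin
      (∁ (L ⨾ x ⨾ L)) ᵀ ⨾ L ⨾ x             ≡⟨ cong ((∁ (L ⨾ x ⨾ L)) ᵀ ⨾_) (ᵀ-involutive (L ⨾ x)) ⟨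
      (∁ (L ⨾ x ⨾ L)) ᵀ ⨾ ((L ⨾ x) ᵀ) ᵀ     ≡⟨ ᵀ-⨾ ((L ⨾ x) ᵀ) (∁ (L ⨾ x ⨾ L)) ⟨
      ((L ⨾ x) ᵀ ⨾ ∁ (L ⨾ x ⨾ L)) ᵀ         ≤⟨ ᵀ-mono schroeder-L⨾x ⟩
      (∁ L) ᵀ                               ≡⟨ cong _ᵀ O≡∁L ⟨
      O ᵀ                                   ≡⟨ ᵀ-O ⟩
      O                                     ∎)
    where
      open ⊆-Reasoning
      schroeder-L⨾x : (L ⨾ x) ᵀ ⨾ ∁ (L ⨾ x ⨾ L) ⊆ ∁ L
      schroeder-L⨾x = subst (λ t → (L ⨾ x) ᵀ ⨾ ∁ t ⊆ ∁ L) (⨾-assoc L x L) (schroeder (L ⨾ x) L)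

  domain⁺⨾L⨾x⊆x⨾L⨾x : ∀ x → domain⁺ x ⨾ L ⨾ x ⊆ x ⨾ L ⨾ x
  domain⁺⨾L⨾x⊆x⨾L⨾x x = begin
      (x ⨾ L ∪ (∁ (L ⨾ x ⨾ L)) ᵀ) ⨾ L ⨾ x              ≡⟨ ⨾-distribʳ (x ⨾ L) _ (L ⨾ x) ⟩
      (x ⨾ L) ⨾ L ⨾ x ∪ (∁ (L ⨾ x ⨾ L)) ᵀ ⨾ L ⨾ x      ≡⟨ cong₂ _∪_ (⨾-assoc x L (L ⨾ x)) (∁[L⨾x⨾L]ᵀ⨾L⨾x≡O x) ⟩
      x ⨾ L ⨾ L ⨾ x ∪ O                                ≤⟨ ∪-least (⨾-monoʳ x (x⨾L⨾y⊆L⨾y L x)) (O⊆x _) ⟩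
      x ⨾ L ⨾ x                                        ∎
    where open ⊆-Reasoning

  connected⇒point : Connected x → Σ B (λ p → IsPoint p × (p ⨾ x ⊆ reach x))
  connected⇒point {x} connected with point-axiom (domain⁺ x) (domain⁺≢O x)
  ... | p , q , p-point , (_ , _ , I⊆qᵀ⨾q) , p⨾qᵀ⊆domain⁺ = p , p-point , (begin
      p ⨾ x                      ≤⟨ ⨾-monoˡ x (x⨾qᵀ⊆y⇒x⊆y⨾L I⊆qᵀ⨾q p⨾qᵀ⊆domain⁺) ⟩
      (domain⁺ x ⨾ L) ⨾ x        ≡⟨ ⨾-assoc (domain⁺ x) L x ⟩
      domain⁺ x ⨾ L ⨾ x          ≤⟨ domain⁺⨾L⨾x⊆x⨾L⨾x x ⟩
      x ⨾ L ⨾ x                  ≤⟨ connected ⟩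
      reach x                    ∎)
    where open ⊆-Reasoning

mainTheorem14 : ∀ {ℓ : Level} (K : KleeneRelationAlgebra ℓ) →
    let open KleeneRelationAlgebra K in
    ∀ (R : B) → Injective R → Univalent R →
    (IsPath R ⇔ Σ B (λ p → IsPoint p × (p ⨾ R ⊆ R * ∪ (R ᵀ) *)))
mainTheorem14 K R injective univalent = mk⇔
  (λ (_ , _ , connected) → connected⇒point K connected)
  (λ (_ , p-point , p⨾R⊆reach) →
     injective , univalent , point⇒connected K injective univalent p-point p⨾R⊆reach)
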